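{- Let $f:\{0,1\}^n\to\{0,1\}^n$ be a monotone Boolean network with interaction graph $G$, and let $I$ be a feedback vertex set of $G$. If $\{x_I: x\text{ a fixed point of }f\}$ has a special $k$-pattern, then $G$ has a special packing of size $k$.
   Context: $f$ is monotone if $x\le y\Rightarrow f(x)\le f(y)$. The interaction graph has vertex set $[n]$ and arc $uv$ (loops allowed) iff $f_v$ depends on $x_u$. $x_I$ is the restriction of $x$ to coordinates in $I$. A feedback vertex set meets every cycle. Cycles are directed without repeated vertices; paths are directed without repeated vertices except that first and last vertex may coincide; internal vertices of $v_0\dots v_\ell$ are $v_1,\dots,v_{\ell-1}$; a source is a vertex of in-degree $0$. A $k$-pattern of $P\subseteq\{0,1\}^m$ is a pair of sequences $(x^1,\dots,x^k)$, $(y^1,\dots,y^k)$, each of $k$ distinct elements of $P$, with $x^p\le y^q$ iff $p\ne q$; it is special if $y^p=1-x^p$ for all $p$. A packing is a set of vertex-disjoint cycles $C_1,\dots,C_k$; a path is principal if none of its arcs and none of its internal vertices lies on a cycle of the packing; the packing is special if for every $C_i$ and vertex $v$ of $C_i$, the existence of a principal path from some $C_j\ne C_i$ to $v$ implies the existence of a principal path from $C_i$ or from a source to $v$ (possibly a cycle through $v$). -}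

module Defs where

open import Data.Nat using (ℕ)
open import Data.Fin using (Fin; _≟_)
open import Data.Bool using (Bool; true; false; not; if_then_else_) renaming (_≤_ to _≤ᵇ_)
open import Data.List using (List; []; _∷_; _++_; [_]; map)
open import Data.List.Membership.Propositional using (_∈_; _∉_)
open import Data.List.Relation.Unary.Unique.Propositional using (Unique)
open import Data.List.Relation.Binary.Pointwise using (Pointwise)
open import Data.Product using (Σ; ∃; ∃-syntax; _×_; _,_)
open import Data.Sum using (_⊎_)
open import Relation.Nullary using (¬_; yes; no)
open import Relation.Binary.PropositionalEquality using (_≡_; _≢_)
open import Function.Bundles using (_⇔_)

State : ℕ → Set
State n = Fin n → Bool

_≤ₛ_ : ∀ {n} → State n → State n → Set
x ≤ₛ y = ∀ i → x i ≤ᵇ y i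

Monotone : ∀ {n} → (State n → State n) → Set
Monotone {n} f = ∀ (x y : State n) → x ≤ₛ y → f x ≤ₛ f y

flipAt : ∀ {n} → State n → Fin n → State n
flipAt x u w with w ≟ u
... | yes _ = not (x u)
... | no  _ = x w

Graph : ℕ → Set₁
Graph n = Fin n → Fin n → Set

IG : ∀ {n} → (State n → State n) → Graph n
IG f u v = ∃[ x ] (f x v ≢ f (flipAt x u) v)

data Chain {n} (E : Graph n) : List (Fin n) → Set where
  []  : Chain E []
  [-] : ∀ {x} → Chain E (x ∷ [])
  _∷_ : ∀ {x y xs} → E x y → Chain E (y ∷ xs) → Chain E (x ∷ y ∷ xs)

data Consec {A : Set} (u v : A) : List A → Set where
  here  : ∀ {xs} → Consec u v (u ∷ v ∷ xs)
  there : ∀ {x xs} → Consec u v xs → Consec u v (x ∷ xs)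

-- a cycle v0 v1 ... v(l-1) v0 (l ≥ 1, loops allowed), vertices distinct
record Cycle {n} (E : Graph n) : Set where
  field
    start    : Fin n
    rest     : List (Fin n)
    arcs     : Chain E (start ∷ rest ++ [ start ])
    distinct : Unique (start ∷ rest)

module _ {n} {E : Graph n} where
  verts : Cycle E → List (Fin n)
  verts C = Cycle.start C ∷ Cycle.rest C

  closedWalk : Cycle E → List (Fin n)
  closedWalk C = Cycle.start C ∷ Cycle.rest C ++ [ Cycle.start C ]

  ArcOn : Fin n → Fin n → Cycle E → Set
  ArcOn u v C = Consec u v (closedWalk C)

-- a path s m1 ... mr t of length ≥ 1 (internal vertices mids);
-- vertices distinct except that s and t may coincide
IsPath : ∀ {n} → Graph n → Fin n → List (Fin n) → Fin n → Set
IsPath E s mids t =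
  Chain E (s ∷ mids ++ [ t ]) × Unique (s ∷ mids) × Unique (mids ++ [ t ])

FeedbackVertexSet : ∀ {n} → Graph n → List (Fin n) → Set
FeedbackVertexSet E I = ∀ (C : Cycle E) → ∃[ v ] (v ∈ verts C × v ∈ I)

Source : ∀ {n} → Graph n → Fin n → Set
Source E s = ∀ u → ¬ E u s

module _ {n} {E : Graph n} {k : ℕ} (C : Fin k → Cycle E) where

  Packing : Set
  Packing = ∀ i j → i ≢ j → ∀ v → v ∈ verts (C i) → v ∉ verts (C j)

  Principal : Fin n → List (Fin n) → Fin n → Set
  Principal s mids t =
    (∀ j u v → Consec u v (s ∷ mids ++ [ t ]) → ¬ ArcOn u v (C j)) ×
    (∀ j w → w ∈ mids → w ∉ verts (C j))

  PrincipalPath : Fin n → Fin n → Set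
  PrincipalPath s t = ∃[ mids ] (IsPath E s mids t × Principal s mids t)

  SpecialPacking : Set
  SpecialPacking =
    ∀ i v → v ∈ verts (C i) →
      (∃[ j ] (j ≢ i × ∃[ s ] (s ∈ verts (C j) × PrincipalPath s v))) →
      (∃[ s ] (s ∈ verts (C i) × PrincipalPath s v)) ⊎
      (∃[ s ] (Source E s × PrincipalPath s v))

_≤ₗ_ : List Bool → List Bool → Set
_≤ₗ_ = Pointwise _≤ᵇ_

SpecialPattern : (List Bool → Set) → ℕ → Set
SpecialPattern P k =
  Σ (Fin k → List Bool) λ xs → Σ (Fin k → List Bool) λ ys →
    (∀ p → P (xs p)) × (∀ p → P (ys p)) ×
    (∀ p q → xs p ≡ xs q → p ≡ q) × (∀ p q → ys p ≡ ys q → p ≡ q) ×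
    (∀ p q → (xs p ≤ₗ ys q) ⇔ (p ≢ q)) ×
    (∀ p → ys p ≡ map not (xs p))

-- x_I, for I listed as a duplicate-free list of coordinates
restrict : ∀ {n} → State n → List (Fin n) → List Bool
restrict x I = map x I

FixedPoint : ∀ {n} → (State n → State n) → State n → Set
FixedPoint f x = ∀ i → f x i ≡ x i

FixRestr : ∀ {n} → (State n → State n) → List (Fin n) → List Bool → Set
FixRestr f I w = ∃[ x ] (FixedPoint f x × restrict x I ≡ w)

module Submission where

-- Let X_i, Y_i be fixed points realising the special pattern on I.  Wherever a fixed
-- point exceeds another, every vertex of that set has an in-neighbour in it, so the set
-- contains a cycle; since I meets every cycle, X_i ≤ Y_j (i ≠ j) lifts from I to all
-- coordinates.  Hence the sets S_i where X_i = 1 and Y_i = 0, nonempty as x^i ≰ y^i, are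
-- pairwise disjoint: S_j lies in the set B_i where X_i = 0 and Y_i = 1.  Choose a cycle
-- C_i in S_i that is initial for reachability through vertices outside B_i.
-- If v on C_i has an in-arc off the packing, then X_i and Y_i force v to have an
-- in-neighbour outside B_i other than its predecessor on C_i, and force every vertex with
-- X_i = Y_i that has an in-arc to have one outside B_i.  Following such in-neighbours
-- backwards from v never closes a cycle (it would avoid I, where X_i and Y_i are
-- complementary), so the search ends at C_i, at a source, or in S_i, from which C_i is
-- reached again by initiality; each time along a principal path.

open import Defs
open import Data.Nat using (ℕ; zero; suc; _≤_; _<_; _∸_; s≤s)
open import Data.Nat.Properties using (∸-monoʳ-<; n<1+n; m≤n⇒m≤1+n)
open import Data.Nat.Induction using (<-wellFounded)
open import Data.Fin using (Fin; zero; suc; _≟_)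
open import Data.Fin.Properties using (any?; injective⇒≤)
open import Data.Bool using (Bool; true; false; not; _∧_) renaming (_≤_ to _≤ᵇ_)
import Data.Bool.Properties as 𝔹
open import Data.Vec.Functional using (head; tail) renaming (_∷_ to _∷ᵥ_)
open import Data.List using (List; []; _∷_; _++_; [_]; map; length; lookup; allFin)
open import Data.List.Properties using (∷-injective)
open import Data.List.Relation.Unary.Any using (here; there)
open import Data.List.Relation.Unary.All as All using (All; []; _∷_)
open import Data.List.Relation.Unary.All.Properties using (¬Any⇒All¬; anti-mono)
import Data.List.Relation.Unary.All.Properties as Allₚ
open import Data.List.Relation.Unary.AllPairs using ([]; _∷_)
open import Data.List.Relation.Unary.Unique.Propositional using (Unique)
open import Data.List.Relation.Unary.Unique.Propositional.Properties using (Unique[x∷xs]⇒x∉xs)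
import Data.List.Relation.Unary.Unique.Propositional.Properties as Uniqueₚ
open import Data.List.Membership.Propositional using (_∈_; _∉_)
open import Data.List.Membership.Propositional.Properties using (∈-lookup; ∈-allFin; ∈-++⁺ˡ; ∈-++⁺ʳ; ∈-++⁻)
open import Data.List.Relation.Binary.Subset.Propositional using (_⊆_)
open import Data.List.Relation.Binary.Pointwise using (Pointwise; []; _∷_)
open import Data.Product using (Σ; ∃; ∃-syntax; _×_; _,_; proj₁; proj₂)
open import Data.Sum using (_⊎_; inj₁; inj₂)
import Data.Sum as Sum
open import Data.Empty using (⊥-elim)
open import Function using (_∘_; id)
open import Function.Bundles using (Equivalence)
import Induction.WellFounded as WF
open import Relation.Binary.Construct.On using (wellFounded)
open import Relation.Binary.Construct.Closure.ReflexiveTransitive using (Star; ε; _◅_; _◅◅_)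
import Relation.Binary.Construct.Closure.ReflexiveTransitive as Star
open import Relation.Nullary using (¬_; Dec; yes; no; ¬?)
open import Relation.Nullary.Decidable using (map′; _×-dec_; _⊎-dec_)
open import Relation.Binary.PropositionalEquality using (_≡_; _≢_; _≗_; refl; sym; trans; cong; subst; subst₂)

-- Finite search

lookup-injective : ∀ {n} (xs : List (Fin n)) → Unique xs →
  ∀ {i j} → lookup xs i ≡ lookup xs j → i ≡ j
lookup-injective (x ∷ xs) U        {zero}  {zero}  eq = refl
lookup-injective (x ∷ xs) U        {zero}  {suc j} eq =
  ⊥-elim (Unique[x∷xs]⇒x∉xs U (subst (_∈ xs) (sym eq) (∈-lookup j)))
lookup-injective (x ∷ xs) U        {suc i} {zero}  eq =
  ⊥-elim (Unique[x∷xs]⇒x∉xs U (subst (_∈ xs) eq (∈-lookup i)))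
lookup-injective (x ∷ xs) (_ ∷ U)  {suc i} {suc j} eq = cong suc (lookup-injective xs U eq)

unique⇒length≤ : ∀ {n} {xs : List (Fin n)} → Unique xs → length xs ≤ n
unique⇒length≤ {xs = xs} U = injective⇒≤ (lookup-injective xs U)

module _ {n : ℕ} {S G : Set} (size : S → ℕ) (size≤ : ∀ s → size s ≤ n) where

  ascend : (∀ s → G ⊎ Σ S λ s′ → size s < size s′) → S → G
  ascend step = WF.All.wfRec (wellFounded (λ s → n ∸ size s) <-wellFounded) _ (λ _ → G) search
    where
    search : ∀ s → (∀ {s′} → n ∸ size s′ < n ∸ size s → G) → G
    search s rec = Sum.[ id , (λ (s′ , grows) → rec (∸-monoʳ-< grows (size≤ s′))) ] (step s)

∃-State? : ∀ {n} {P : State n → Set} → (∀ {x y} → x ≗ y → P x → P y) →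
  (∀ x → Dec (P x)) → Dec (∃ P)
∃-State? {zero} resp P? = map′ (_ ,_) (λ (x , px) → resp (λ ()) px) (P? (λ ()))
∃-State? {suc n} {P} resp P? = map′ join split (extension? true ⊎-dec extension? false)
  where
  extension? : ∀ b → Dec (∃ λ x → P (b ∷ᵥ x))
  extension? b = ∃-State? (λ x≗y → resp λ { zero → refl ; (suc i) → x≗y i }) (P? ∘ (b ∷ᵥ_))

  join : (∃ λ x → P (true ∷ᵥ x)) ⊎ (∃ λ x → P (false ∷ᵥ x)) → ∃ P
  join = Sum.[ (λ (x , px) → _ , px) , (λ (x , px) → _ , px) ]

  split : ∃ P → (∃ λ x → P (true ∷ᵥ x)) ⊎ (∃ λ x → P (false ∷ᵥ x))
  split (x , px) = by-head (head x) (tail x) (resp (λ { zero → refl ; (suc i) → refl }) px)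
    where
    by-head : ∀ b x′ → P (b ∷ᵥ x′) → (∃ λ x → P (true ∷ᵥ x)) ⊎ (∃ λ x → P (false ∷ᵥ x))
    by-head true  x′ p = inj₁ (x′ , p)
    by-head false x′ p = inj₂ (x′ , p)

-- Walks, paths and cycles

unique-rotate : ∀ {A : Set} (xs : List A) {z} → Unique (xs ++ [ z ]) → Unique (z ∷ xs)
unique-rotate []       _          = [] ∷ []
unique-rotate (x ∷ xs) (x∉ ∷ U) with unique-rotate xs U | Allₚ.++⁻ xs x∉
... | z∉ ∷ U′ | x∉xs , x≢z ∷ [] = ((x≢z ∘ sym) ∷ z∉) ∷ x∉xs ∷ U′

consec-pred : ∀ {A : Set} {x w : A} {xs} → w ∈ xs → ∃[ a ] Consec a w (x ∷ xs)
consec-pred (here refl) = _ , here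
consec-pred (there w∈) = let (a , c) = consec-pred w∈ in a , there c

consec⇒∈ˡ : ∀ {A : Set} {a b : A} {xs} → Consec a b xs → a ∈ xs
consec⇒∈ˡ here      = here refl
consec⇒∈ˡ (there c) = there (consec⇒∈ˡ c)

consec⇒∈ʳ : ∀ {A : Set} {a b x : A} {xs} → Consec a b (x ∷ xs) → b ∈ xs
consec⇒∈ʳ {xs = _ ∷ _} here      = here refl
consec⇒∈ʳ {xs = _ ∷ _} (there c) = there (consec⇒∈ʳ c)

consec-pred-unique : ∀ {A : Set} {x a a′ b : A} {xs} → Unique xs →
  Consec a b (x ∷ xs) → Consec a′ b (x ∷ xs) → a ≡ a′
consec-pred-unique U       here      here       = refl
consec-pred-unique U       here      (there c′) = ⊥-elim (Unique[x∷xs]⇒x∉xs U (consec⇒∈ʳ c′))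
consec-pred-unique U       (there c) here       = ⊥-elim (Unique[x∷xs]⇒x∉xs U (consec⇒∈ʳ c))
consec-pred-unique (_ ∷ U) (there c) (there c′) = consec-pred-unique U c c′

Induced : ∀ {n} → (Fin n → Set) → Graph n → Graph n
Induced P E x y = P x × P y × E x y

module _ {n : ℕ} {E : Graph n} where

  open import Data.List.Membership.DecPropositional (_≟_ {n}) using (_∈?_)

  chain-map : ∀ {F : Graph n} → (∀ {a b} → E a b → F a b) → ∀ {L} → Chain E L → Chain F L
  chain-map g []      = []
  chain-map g [-]     = [-]
  chain-map g (e ∷ c) = g e ∷ chain-map g c

  chain-consec : ∀ {L a b} → Chain E L → Consec a b L → E a b
  chain-consec (e ∷ c) here      = e
  chain-consec (e ∷ c) (there q) = chain-consec c q

  cycle-map : ∀ {F : Graph n} → (∀ {a b} → E a b → F a b) → Cycle E → Cycle F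
  cycle-map g C = record { Cycle C ; arcs = chain-map g (Cycle.arcs C) }

  ∈-closedWalk⇒∈-verts : ∀ (C : Cycle E) {v} → v ∈ closedWalk C → v ∈ verts C
  ∈-closedWalk⇒∈-verts C v∈ with ∈-++⁻ (verts C) v∈
  ... | inj₁ v∈C         = v∈C
  ... | inj₂ (here refl) = here refl

  arcOn⇒∈-verts : ∀ (C : Cycle E) {u v} → ArcOn u v C → v ∈ verts C
  arcOn⇒∈-verts C arc = ∈-closedWalk⇒∈-verts C (there (consec⇒∈ʳ arc))

  cycle-pred : ∀ (C : Cycle E) {v} → v ∈ verts C →
    ∃[ p ] (ArcOn p v C × ∀ {u} → ArcOn u v C → u ≡ p)
  cycle-pred C v∈ =
    let (p , arc) = consec-pred (rotate v∈) in p , arc , λ arc′ → consec-pred-unique rest-unique arc′ arc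
    where
    open Cycle C
    rotate : ∀ {v} → v ∈ start ∷ rest → v ∈ rest ++ [ start ]
    rotate (here refl) = ∈-++⁺ʳ rest (here refl)
    rotate (there v∈)  = ∈-++⁺ˡ v∈
    rest-unique : Unique (rest ++ [ start ])
    rest-unique with distinct
    ... | start∉ ∷ U = Uniqueₚ.++⁺ U ([] ∷ []) λ { (v∈ , here refl) → All.lookup start∉ v∈ refl }

  -- A walk lists its vertices as departures ++ [ end ], the shape used by IsPath and Cycle.
  departures : ∀ {x z} → Star E x z → List (Fin n)
  departures     ε       = []
  departures {x} (_ ◅ w) = x ∷ departures w

  vertices : ∀ {x z} → Star E x z → List (Fin n)
  vertices {z = z} w = departures w ++ [ z ]

  start∈vertices : ∀ {x z} (w : Star E x z) → x ∈ vertices w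
  start∈vertices ε       = here refl
  start∈vertices (_ ◅ _) = here refl

  end∈vertices : ∀ {x z} (w : Star E x z) → z ∈ vertices w
  end∈vertices w = ∈-++⁺ʳ (departures w) (here refl)

  walk-chain : ∀ {x z} (w : Star E x z) → Chain E (vertices w)
  walk-chain ε             = [-]
  walk-chain (e ◅ ε)       = e ∷ [-]
  walk-chain (e ◅ (e′ ◅ w)) = e ∷ walk-chain (e′ ◅ w)

  walk-chain-∷ʳ : ∀ {x z y} (w : Star E x z) → E z y → Chain E (vertices w ++ [ y ])
  walk-chain-∷ʳ ε              e = e ∷ [-]
  walk-chain-∷ʳ (e′ ◅ ε)       e = e′ ∷ e ∷ [-]
  walk-chain-∷ʳ (e′ ◅ (e″ ◅ w)) e = e′ ∷ walk-chain-∷ʳ (e″ ◅ w) e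

  suffix-unique : ∀ {x z u} (w : Star E x z) → Unique (vertices w) → u ∈ vertices w →
    Σ (Star E u z) (Unique ∘ vertices)
  suffix-unique ε       U       (here refl) = ε , U
  suffix-unique (e ◅ w) U       (here refl) = e ◅ w , U
  suffix-unique (e ◅ w) (_ ∷ U) (there u∈)  = suffix-unique w U u∈

  shortcut : ∀ {x z} → Star E x z → Σ (Star E x z) (Unique ∘ vertices)
  shortcut ε = ε , [] ∷ []
  shortcut {x} (e ◅ w) with shortcut w
  ... | w′ , U with x ∈? vertices w′
  ...   | yes x∈ = suffix-unique w′ U x∈
  ...   | no  x∉ = e ◅ w′ , ¬Any⇒All¬ _ x∉ ∷ U

  walk⇒path : ∀ {s y t} → E s y → Star E y t → ∃[ mids ] IsPath E s mids t
  walk⇒path {s} {t = t} e w with s ≟ t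
  ... | yes refl =
    let (w′ , U) = shortcut w in departures w′ , walk-chain (e ◅ w′) , unique-rotate _ U , U
  ... | no s≢t with shortcut (e ◅ w)
  ...   | ε       , _ = ⊥-elim (s≢t refl)
  ...   | e′ ◅ w′ , U@(_ ∷ U-tail) with unique-rotate (s ∷ departures w′) U
  ...     | _ ∷ U′ = departures w′ , walk-chain (e′ ◅ w′) , U′ , U-tail

  close-walk : ∀ {x z} (w : Star E x z) → Unique (vertices w) → E z x →
    Σ (Cycle E) λ C → verts C ≡ vertices w
  close-walk ε       U e = record { start = _ ; rest = [] ; arcs = e ∷ [-] ; distinct = U } , refl
  close-walk (e′ ◅ w) U e =
    record { start = _ ; rest = vertices w ; arcs = walk-chain-∷ʳ (e′ ◅ w) e ; distinct = U } , refl

  prefix-unique : ∀ {x z u} (w : Star E x z) → Unique (vertices w) → u ∈ vertices w →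
    Σ (Star E x u) λ w′ →
      Unique (vertices w′) × vertices w′ ⊆ vertices w × (z ∈ vertices w′ → u ≡ z)
  prefix-unique ε       U (here refl) = ε , U , id , λ _ → refl
  prefix-unique (e ◅ w) U (here refl) =
    ε , [] ∷ [] , (λ { (here refl) → here refl }) , λ { (here z≡x) → sym z≡x }
  prefix-unique (e ◅ w) (x∉ ∷ U) (there u∈) with prefix-unique w U u∈
  ... | w′ , U′ , w′⊆w , ends = e ◅ w′ , anti-mono w′⊆w x∉ ∷ U′ , ⊆-there , ends′
    where
    ⊆-there : vertices (e ◅ w′) ⊆ vertices (e ◅ w)
    ⊆-there (here refl) = here refl
    ⊆-there (there v∈)  = there (w′⊆w v∈)
    ends′ : _ ∈ vertices (e ◅ w′) → _ ≡ _
    ends′ (here refl) = ⊥-elim (All.lookup x∉ (end∈vertices w) refl)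
    ends′ (there z∈)  = ends z∈

  cycle-through : ∀ {x z u} (w : Star E x z) → Unique (vertices w) → u ∈ vertices w → E u x →
    Σ (Cycle E) λ C → verts C ⊆ vertices w × (z ∈ verts C → u ≡ z)
  cycle-through w U u∈ e with prefix-unique w U u∈
  ... | w′ , U′ , w′⊆w , ends with close-walk w′ U′ e
  ... | C , C≡w′ = C , w′⊆w ∘ C⊆w′ , ends ∘ C⊆w′
    where
    C⊆w′ : verts C ⊆ vertices w′
    C⊆w′ = subst (_ ∈_) C≡w′

  cycle-within : ∀ {P : Fin n → Set} → (∀ {h} → P h → ∃[ u ] (P u × E u h)) →
    ∀ {x} → P x → Σ (Cycle E) λ C → ∀ {v} → v ∈ verts C → P v
  cycle-within {P} in-neighbour {x} Px = ascend size size≤ step (x , ε , [] ∷ [] , Px ∷ [])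
    where
    Backward : Set
    Backward = ∃[ h ] Σ (Star E h x) λ w → Unique (vertices w) × All P (vertices w)
    size : Backward → ℕ
    size (_ , w , _) = length (vertices w)
    size≤ : ∀ s → size s ≤ n
    size≤ (_ , _ , U , _) = unique⇒length≤ U
    step : ∀ s → (Σ (Cycle E) λ C → ∀ {v} → v ∈ verts C → P v) ⊎
                 Σ Backward λ s′ → size s < size s′
    step (h , w , U , all) with in-neighbour (All.lookup all (start∈vertices w))
    ... | u , Pu , e with u ∈? vertices w
    ...   | yes u∈ = let (C , C⊆w , _) = cycle-through w U u∈ e in inj₁ (C , All.lookup all ∘ C⊆w)
    ...   | no  u∉ = inj₂ ((u , e ◅ w , ¬Any⇒All¬ _ u∉ ∷ U , Pu ∷ all) , n<1+n _)

  induce : ∀ {P : Fin n → Set} {x z} (w : Star E x z) → All P (vertices w) → Star (Induced P E) x z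
  induce ε       _          = ε
  induce (e ◅ w) (Px ∷ all) = (Px , All.lookup all (start∈vertices w) , e) ◅ induce w all

  Avoiding : (Fin n → Set) → Graph n
  Avoiding D a b = E a b × ¬ D b

  Exit : (Fin n → Set) → Fin n → Set
  Exit D z = ∃[ c ] ∃[ y ] (D c × E c y × ¬ D y × Star (Avoiding D) y z)

  exit-or-avoid : ∀ {D : Fin n → Set} → (∀ v → Dec (D v)) → ∀ {x z} → ¬ D z → Star E x z →
    Exit D z ⊎ (¬ D x × Star (Avoiding D) x z)
  exit-or-avoid D? ¬Dz ε = inj₂ (¬Dz , ε)
  exit-or-avoid D? {x} ¬Dz (e ◅ w) with exit-or-avoid D? ¬Dz w
  ... | inj₁ exit = inj₁ exit
  ... | inj₂ (¬Dy , w′) with D? x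
  ...   | yes Dx = inj₁ (x , _ , Dx , e , ¬Dy , w′)
  ...   | no ¬Dx = inj₂ (¬Dx , (e , ¬Dy) ◅ w′)

  last-exit : ∀ {D : Fin n → Set} → (∀ v → Dec (D v)) →
    ∀ {x z} → D x → ¬ D z → Star E x z → Exit D z
  last-exit D? Dx ¬Dz w with exit-or-avoid D? ¬Dz w
  ... | inj₁ exit      = exit
  ... | inj₂ (¬Dx , _) = ⊥-elim (¬Dx Dx)

  private
    Star≤ : ℕ → Fin n → Fin n → Set
    Star≤ zero    x z = x ≡ z
    Star≤ (suc k) x z = x ≡ z ⊎ ∃[ y ] (E x y × Star≤ k y z)

  star? : (∀ x y → Dec (E x y)) → ∀ x z → Dec (Star E x z)
  star? E? x z = map′ (from n) (to ∘ shortcut) (bounded? n x z)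
    where
    bounded? : ∀ k x z → Dec (Star≤ k x z)
    bounded? zero    x z = x ≟ z
    bounded? (suc k) x z = (x ≟ z) ⊎-dec any? (λ y → E? x y ×-dec bounded? k y z)
    from : ∀ k {x z} → Star≤ k x z → Star E x z
    from zero    refl                = ε
    from (suc k) (inj₁ refl)         = ε
    from (suc k) (inj₂ (y , e , w)) = e ◅ from k w
    short : ∀ k {x z} (w : Star E x z) → length (vertices w) ≤ suc k → Star≤ k x z
    short zero    ε              _         = refl
    short (suc k) ε              _         = inj₁ refl
    short zero    (e ◅ ε)        (s≤s ())
    short zero    (e ◅ (_ ◅ _))  (s≤s ())
    short (suc k) (e ◅ w)        (s≤s len) = inj₂ (_ , e , short k w len)
    to : ∀ {x z} → Σ (Star E x z) (Unique ∘ vertices) → Star≤ n x z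
    to (w , U) = short n w (m≤n⇒m≤1+n (unique⇒length≤ U))

minimal-element : ∀ {n} {R : Fin n → Fin n → Set} {P : Fin n → Set} →
  (∀ {x} → R x x) → (∀ {x y z} → R x y → R y z → R x z) → (∀ x y → Dec (R x y)) →
  (∀ x → Dec (P x)) → ∀ {x} → P x → ∃[ m ] (P m × ∀ {y} → P y → R y m → R m y)
minimal-element {n} {R} {P} R-refl R-trans R? P? {x} Px = ascend size size≤ step (x , [] , Px , [] ∷ [] , [])
  where
  Descent : Set
  Descent = ∃[ h ] ∃[ L ] (P h × Unique (h ∷ L) × All (R h) L)
  size : Descent → ℕ
  size (_ , L , _) = length L
  size≤ : ∀ s → size s ≤ n
  size≤ (_ , _ , _ , _ ∷ U , _) = unique⇒length≤ U
  step : ∀ s → (∃[ m ] (P m × ∀ {y} → P y → R y m → R m y)) ⊎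
               Σ Descent λ s′ → size s < size s′
  step (h , L , Ph , U , below) with any? (λ r → P? r ×-dec R? r h ×-dec ¬? (R? h r))
  ... | yes (r , Pr , Rrh , ¬Rhr) =
    inj₂ ((r , h ∷ L , Pr , r∉ ∷ U , Rrh ∷ All.map (R-trans Rrh) below) , n<1+n _)
    where
    r∉ : All (r ≢_) (h ∷ L)
    r∉ = (λ { refl → ¬Rhr R-refl }) ∷ All.tabulate λ { r∈ refl → ¬Rhr (All.lookup below r∈) }
  ... | no ∄r = inj₁ (h , Ph , minimal)
    where
    minimal : ∀ {y} → P y → R y h → R h y
    minimal {y} Py Ryh with R? h y
    ... | yes Rhy = Rhy
    ... | no ¬Rhy = ⊥-elim (∄r (y , Py , Ryh , ¬Rhy))

-- Monotone Boolean networks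

flipAt-same : ∀ {n} (x : State n) u → flipAt x u u ≡ not (x u)
flipAt-same x u with u ≟ u
... | yes _  = refl
... | no u≢u = ⊥-elim (u≢u refl)

flipAt-other : ∀ {n} (x : State n) {u w} → w ≢ u → flipAt x u w ≡ x w
flipAt-other x {u} {w} w≢u with w ≟ u
... | yes w≡u = ⊥-elim (w≢u w≡u)
... | no  _   = refl

flipAt-cong : ∀ {n} {x y : State n} u → x ≗ y → flipAt x u ≗ flipAt y u
flipAt-cong u x≗y w with w ≟ u
... | yes _ = cong not (x≗y u)
... | no  _ = x≗y w

Excess : ∀ {n} → State n → State n → Fin n → Set
Excess a b w = a w ≡ true × b w ≡ false

excess? : ∀ {n} (a b : State n) w → Dec (Excess a b w)
excess? a b w = (a w 𝔹.≟ true) ×-dec (b w 𝔹.≟ false)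

split-decision : ∀ {A R : Set} {p q c : A} → p ≢ q → p ≡ c ⊎ R → q ≡ c ⊎ R → R
split-decision p≢q (inj₁ p≡c) (inj₁ q≡c) = ⊥-elim (p≢q (trans p≡c (sym q≡c)))
split-decision _   (inj₂ r)   _          = r
split-decision _   (inj₁ _)   (inj₂ r)   = r

meet-differs : ∀ p q → q ∧ p ≢ p → p ≡ true × q ≡ false
meet-differs p     true  differ = ⊥-elim (differ refl)
meet-differs false false differ = ⊥-elim (differ refl)
meet-differs true  false differ = refl , refl

¬excess⇒≤ : ∀ {p q} → ¬ (p ≡ true × q ≡ false) → p ≤ᵇ q
¬excess⇒≤ {false} {q}     _       = 𝔹.≤-minimum q
¬excess⇒≤ {true}  {true}  _       = 𝔹.≤-refl
¬excess⇒≤ {true}  {false} ¬excess = ⊥-elim (¬excess (refl , refl))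

excess⇒≰ : ∀ {p q} → p ≡ true × q ≡ false → ¬ (p ≤ᵇ q)
excess⇒≰ (refl , refl) ()

override : ∀ {n} {M : Fin n → Set} → (∀ w → Dec (M w)) → State n → State n → State n
override M? z base w with M? w
... | yes _ = z w
... | no  _ = base w

module MonotoneNetwork {n : ℕ} (f : State n → State n) (mono : Monotone f) where

  -- Without function extensionality, only monotonicity makes f respect pointwise equality.
  f-cong : ∀ {x y} → x ≗ y → f x ≗ f y
  f-cong x≗y v =
    𝔹.≤-antisym (mono _ _ (𝔹.≤-reflexive ∘ x≗y) v) (mono _ _ (𝔹.≤-reflexive ∘ sym ∘ x≗y) v)

  IG? : ∀ u v → Dec (IG f u v)
  IG? u v = ∃-State? resp (λ x → ¬? (f x v 𝔹.≟ f (flipAt x u) v))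
    where
    resp : ∀ {x y} → x ≗ y → f x v ≢ f (flipAt x u) v → f y v ≢ f (flipAt y u) v
    resp x≗y differ same = differ (trans (f-cong x≗y v) (trans same (sym (f-cong (flipAt-cong u x≗y) v))))

  preserved : ∀ c {x y} h → (∀ w → x w ≡ not c ⊎ x w ≡ y w) → f x h ≡ c → f y h ≡ c
  preserved true {x} {y} h toward fx≡c =
    𝔹.≤-antisym (𝔹.≤-maximum _) (subst (_≤ᵇ f y h) fx≡c (mono x y le h))
    where
    le : x ≤ₛ y
    le w with toward w
    ... | inj₁ xw≡false = subst (_≤ᵇ y w) (sym xw≡false) (𝔹.≤-minimum _)
    ... | inj₂ xw≡yw    = 𝔹.≤-reflexive xw≡yw
  preserved false {x} {y} h toward fx≡c =
    𝔹.≤-antisym (subst (f y h ≤ᵇ_) fx≡c (mono y x le h)) (𝔹.≤-minimum _)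
    where
    le : y ≤ₛ x
    le w with toward w
    ... | inj₁ xw≡true = subst (y w ≤ᵇ_) (sym xw≡true) (𝔹.≤-maximum _)
    ... | inj₂ xw≡yw   = 𝔹.≤-reflexive (sym xw≡yw)

  agree-or-arc : ∀ x y v → f x v ≡ f y v ⊎ ∃[ u ] (x u ≢ y u × IG f u v)
  -- Move from x to y one differing coordinate at a time.
  agree-or-arc x y v = along (allFin n) x (λ _ → inj₁ refl) (λ w w∉ → ⊥-elim (w∉ (∈-allFin w)))
    where
    Result : State n → Set
    Result z = f z v ≡ f y v ⊎ ∃[ u ] (x u ≢ y u × IG f u v)
    elsewhere : ∀ {w cs} c → w ∉ cs → w ≡ c ⊎ w ∉ c ∷ cs
    elsewhere {w} c w∉ with w ≟ c
    ... | yes w≡c = inj₁ w≡c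
    ... | no  w≢c = inj₂ λ { (here w≡c) → w≢c w≡c ; (there w∈) → w∉ w∈ }
    along : ∀ cs z → (∀ w → z w ≡ x w ⊎ z w ≡ y w) → (∀ w → w ∉ cs → z w ≡ y w) → Result z
    along []       z _     agree = inj₁ (f-cong (λ w → agree w λ ()) v)
    along (c ∷ cs) z mixed agree with z c 𝔹.≟ y c
    ... | yes zc≡yc = along cs z mixed λ w w∉ → Sum.[ (λ { refl → zc≡yc }) , agree w ] (elsewhere c w∉)
    ... | no  zc≢yc with f z v 𝔹.≟ f (flipAt z c) v | mixed c
    ...   | no  differ | inj₁ zc≡xc = inj₂ (c , (λ xc≡yc → zc≢yc (trans zc≡xc xc≡yc)) , z , differ)
    ...   | no  _      | inj₂ zc≡yc = ⊥-elim (zc≢yc zc≡yc)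
    ...   | yes same   | _          = Sum.map₁ (trans same) (along cs (flipAt z c) mixed′ agree′)
      where
      flipped : flipAt z c c ≡ y c
      flipped = trans (flipAt-same z c) (sym (𝔹.¬-not (zc≢yc ∘ sym)))
      mixed′ : ∀ w → flipAt z c w ≡ x w ⊎ flipAt z c w ≡ y w
      mixed′ w = by-cases (w ≟ c)
        where
        by-cases : Dec (w ≡ c) → flipAt z c w ≡ x w ⊎ flipAt z c w ≡ y w
        by-cases (yes refl) = inj₂ flipped
        by-cases (no  w≢c)  = Sum.map (trans (flipAt-other z w≢c)) (trans (flipAt-other z w≢c)) (mixed w)
      agree′ : ∀ w → w ∉ cs → flipAt z c w ≡ y w
      agree′ w w∉ with elsewhere c w∉
      ... | inj₁ refl = flipped
      ... | inj₂ w∉′  = trans (flipAt-other z λ { refl → w∉′ (here refl) }) (agree w w∉′)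

  excess-in-neighbour : ∀ {a b} → FixedPoint f a → FixedPoint f b →
    ∀ {r} → Excess a b r → ∃[ u ] (Excess a b u × IG f u r)
  excess-in-neighbour {a} {b} fix-a fix-b {r} (ar , br) with agree-or-arc (λ w → b w ∧ a w) a r
  ... | inj₂ (u , differ , arc) = u , meet-differs (a u) (b u) differ , arc
  ... | inj₁ same with trans (sym meet-false) (trans same (trans (fix-a r) ar))
    where
    meet-false : f (λ w → b w ∧ a w) r ≡ false
    meet-false = preserved false r toward (trans (fix-b r) br)
      where
      toward : ∀ w → b w ≡ true ⊎ b w ≡ b w ∧ a w
      toward w with b w
      ... | true  = inj₁ refl
      ... | false = inj₂ refl
  ... | ()

  excess-cycle : ∀ {a b} → FixedPoint f a → FixedPoint f b → ∀ {r} → Excess a b r →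
    Σ (Cycle (IG f)) λ C → ∀ {v} → v ∈ verts C → Excess a b v
  excess-cycle fix-a fix-b = cycle-within (excess-in-neighbour fix-a fix-b)

  fixedPoint-≤ : ∀ {I} → FeedbackVertexSet (IG f) I → ∀ {a b} → FixedPoint f a → FixedPoint f b →
    (∀ {u} → u ∈ I → a u ≤ᵇ b u) → a ≤ₛ b
  fixedPoint-≤ fvs {a} {b} fix-a fix-b a≤b-on-I r with excess? a b r
  ... | no ¬excess = ¬excess⇒≤ ¬excess
  ... | yes excess with excess-cycle fix-a fix-b excess
  ...   | C , C⊆excess with fvs C
  ...     | w , w∈C , w∈I = ⊥-elim (excess⇒≰ (C⊆excess w∈C) (a≤b-on-I w∈I))

  forced : ∀ c {M : Fin n → Set} → (∀ w → Dec (M w)) → ∀ {base} z {h} → f base h ≡ c →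
    (∀ {w} → M w → base w ≡ not c ⊎ base w ≡ z w) → f z h ≡ c ⊎ ∃[ w ] (¬ M w × IG f w h)
  forced c {M} M? {base} z {h} fbase≡c marked with agree-or-arc z (override M? z base) h
  ... | inj₁ same = inj₁ (trans same (preserved c h toward fbase≡c))
    where
    toward : ∀ w → base w ≡ not c ⊎ base w ≡ override M? z base w
    toward w with M? w
    ... | yes m = marked m
    ... | no  _ = inj₂ refl
  ... | inj₂ (u , differ , arc) with M? u
  ...   | yes _ = ⊥-elim (differ refl)
  ...   | no ¬m = inj₂ (u , ¬m , arc)

-- The special packing

module SpecialPackingConstruction
  {n : ℕ} (f : State n → State n) (mono : Monotone f)
  (I : List (Fin n)) (fvs : FeedbackVertexSet (IG f) I)
  {k : ℕ} (X Y : Fin k → State n)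
  (fix-X : ∀ i → FixedPoint f (X i)) (fix-Y : ∀ i → FixedPoint f (Y i))
  (X≤Y : ∀ i j → i ≢ j → X i ≤ₛ Y j)
  (complementary : ∀ i {u} → u ∈ I → Y i u ≡ not (X i u))
  (X≰Y : ∀ i → ∃ (Excess (X i) (Y i)))
  where

  open MonotoneNetwork f mono
  open import Data.List.Membership.DecPropositional (_≟_ {n}) using (_∈?_)

  S B : Fin k → Fin n → Set
  S i = Excess (X i) (Y i)
  B i = Excess (Y i) (X i)

  Q : Fin k → Fin n → Set
  Q i w = ¬ B i w

  Q? : ∀ i w → Dec (Q i w)
  Q? i w = ¬? (excess? (Y i) (X i) w)

  S⇒Q : ∀ {i w} → S i w → Q i w
  S⇒Q (Xw≡true , _) (_ , Xw≡false) with trans (sym Xw≡true) Xw≡false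
  ... | ()

  E⇒Q : ∀ {i w} → X i w ≡ Y i w → Q i w
  E⇒Q Xw≡Yw (Yw≡true , Xw≡false) with trans (sym Xw≡false) (trans Xw≡Yw Yw≡true)
  ... | ()

  Q⇒S⊎E : ∀ {i w} → Q i w → S i w ⊎ X i w ≡ Y i w
  Q⇒S⊎E {i} {w} ¬B with X i w | Y i w
  ... | true  | true  = inj₂ refl
  ... | true  | false = inj₁ (refl , refl)
  ... | false | false = inj₂ refl
  ... | false | true  = ⊥-elim (¬B (refl , refl))

  E∉I : ∀ {i w} → X i w ≡ Y i w → w ∉ I
  E∉I {i} Xw≡Yw w∈I = 𝔹.not-¬ refl (trans Xw≡Yw (complementary i w∈I))

  S⇒B : ∀ {i j w} → i ≢ j → S j w → B i w
  S⇒B {i} {j} {w} i≢j (Xjw≡true , Yjw≡false) =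
    𝔹.≤-antisym (𝔹.≤-maximum _) (subst (_≤ᵇ Y i w) Xjw≡true (X≤Y j i (i≢j ∘ sym) w)) ,
    𝔹.≤-antisym (subst (X i w ≤ᵇ_) Yjw≡false (X≤Y i j i≢j w)) (𝔹.≤-minimum _)

  S-disjoint : ∀ {i j w} → i ≢ j → S i w → ¬ S j w
  S-disjoint i≢j Si = S⇒Q Si ∘ S⇒B i≢j

  Reach : Fin k → Fin n → Fin n → Set
  Reach i = Star (Induced (Q i) (IG f))

  Initial : Fin k → Cycle (IG f) → Set
  Initial i C = ∀ {r c} → S i r → c ∈ verts C → Reach i r c → Reach i c r

  initial-cycle : ∀ i → Σ (Cycle (IG f)) λ C → (∀ {v} → v ∈ verts C → S i v) × Initial i C
  initial-cycle i with minimal-element ε _◅◅_ reach? (excess? (X i) (Y i)) (proj₂ (X≰Y i))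
    where
    reach? : ∀ x y → Dec (Reach i x y)
    reach? = star? (λ x y → Q? i x ×-dec Q? i y ×-dec IG? x y)
  ... | r₀ , Sr₀ , minimal with cycle-within in-neighbour (Sr₀ , ε)
    where
    in-neighbour : ∀ {h} → S i h × Reach i h r₀ → ∃[ u ] ((S i u × Reach i u r₀) × IG f u h)
    in-neighbour (Sh , h⇝r₀) =
      let (u , Su , arc) = excess-in-neighbour (fix-X i) (fix-Y i) Sh
      in u , (Su , (S⇒Q Su , S⇒Q Sh , arc) ◅ h⇝r₀) , arc
  ... | C , C⊆ = C , proj₁ ∘ C⊆ , λ Sr c∈C r⇝c →
    let c⇝r₀ = proj₂ (C⊆ c∈C) in c⇝r₀ ◅◅ minimal Sr (r⇝c ◅◅ c⇝r₀)

  module Pinning (i : Fin k) where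

    bound : Bool → State n
    bound true  = X i
    bound false = Y i

    bound-fixed : ∀ c → FixedPoint f (bound c)
    bound-fixed true  = fix-X i
    bound-fixed false = fix-Y i

    bound-S : ∀ {w} c → S i w → bound c w ≡ c
    bound-S true  = proj₁
    bound-S false = proj₂

    bound-E : ∀ {w} c → X i w ≡ c → Y i w ≡ c → bound c w ≡ c
    bound-E true  Xw≡c _    = Xw≡c
    bound-E false _    Yw≡c = Yw≡c

    bound-B : ∀ {w} c → B i w → bound c w ≡ not c
    bound-B true  = proj₂
    bound-B false = proj₁

    settle : ∀ {M : Fin n → Set} → (∀ w → Dec (M w)) → ∀ c z {h} → bound c h ≡ c →
      (∀ {w} → M w → B i w ⊎ bound c w ≡ z w) → f z h ≡ c ⊎ ∃[ w ] (¬ M w × IG f w h)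
    settle M? c z pinned marked =
      forced c M? z (trans (bound-fixed c _) pinned) (Sum.map₁ (bound-B c) ∘ marked)

  module _ (C : Fin k → Cycle (IG f)) (C⊆S : ∀ i {v} → v ∈ verts (C i) → S i v)
    (initial : ∀ i → Initial i (C i)) where

    packing : Packing C
    packing i j i≢j v v∈Ci v∈Cj = S-disjoint i≢j (C⊆S i v∈Ci) (C⊆S j v∈Cj)

    OffPacking : Fin n → Set
    OffPacking w = ∀ j → w ∉ verts (C j)

    OffPackingArc : Fin n → Fin n → Set
    OffPackingArc a b = ∀ j → ¬ ArcOn a b (C j)

    offPacking⇒offPackingArc : ∀ {a b} → OffPacking b → OffPackingArc a b
    offPacking⇒offPackingArc b-off j arc = b-off j (arcOn⇒∈-verts (C j) arc)

    Q⇒offPacking : ∀ {i w} → Q i w → w ∉ verts (C i) → OffPacking w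
    Q⇒offPacking {i} Qw w∉Ci j w∈Cj with j ≟ i
    ... | yes refl = w∉Ci w∈Cj
    ... | no  j≢i  = Qw (S⇒B (j≢i ∘ sym) (C⊆S j w∈Cj))

    Admissible : Fin n → Graph n
    Admissible t a b = IG f a b × OffPackingArc a b × (b ≡ t ⊎ OffPacking b)

    admissible⇒principal : ∀ {s y t} → Admissible t s y → Star (Admissible t) y t → PrincipalPath C s t
    admissible⇒principal {s} {t = t} arc walk with walk⇒path arc walk
    ... | mids , chain , Us , Ut = mids , (chain-map proj₁ chain , Us , Ut) , arcs-off , inner-off
      where
      arcs-off : ∀ j u v → Consec u v (s ∷ mids ++ [ t ]) → ¬ ArcOn u v (C j)
      arcs-off j u v c = proj₁ (proj₂ (chain-consec chain c)) j
      inner-off : ∀ j w → w ∈ mids → w ∉ verts (C j)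
      inner-off j w w∈ with consec-pred {x = s} (∈-++⁺ˡ {ys = [ t ]} w∈)
      ... | _ , c with proj₂ (proj₂ (chain-consec chain c)) | unique-rotate mids Ut
      ...   | inj₁ refl  | t∉mids ∷ _ = ⊥-elim (All.lookup t∉mids w∈ refl)
      ...   | inj₂ w-off | _          = w-off j

    Supplied : Fin k → Fin n → Set
    Supplied i v = (∃[ s ] (s ∈ verts (C i) × PrincipalPath C s v)) ⊎
                   (∃[ s ] (Source (IG f) s × PrincipalPath C s v))

    module Backtrack (i : Fin k) {v} (v∈Ci : v ∈ verts (C i)) {a} (a→v : IG f a v)
      (a→v-off : OffPackingArc a v) where

      open Pinning i

      Sv : S i v
      Sv = C⊆S i v∈Ci

      p : Fin n
      p = proj₁ (cycle-pred (C i) v∈Ci)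

      p→v : ArcOn p v (C i)
      p→v = proj₁ (proj₂ (cycle-pred (C i) v∈Ci))

      Sp : S i p
      Sp = C⊆S i (∈-closedWalk⇒∈-verts (C i) (consec⇒∈ˡ p→v))

      a≢p : a ≢ p
      a≢p refl = a→v-off i p→v

      off-packing-into-v : ∀ {u} → u ≢ p → OffPackingArc u v
      off-packing-into-v u≢p j u→v with j ≟ i
      ... | yes refl = u≢p (proj₂ (proj₂ (cycle-pred (C i) v∈Ci)) u→v)
      ... | no  j≢i  = packing j i j≢i v (arcOn⇒∈-verts (C j) u→v) v∈Ci

      -- f_v(z) = z_p unless v has an in-neighbour outside B_i ∪ {p}; but f_v separates z
      -- from z with a flipped, and a ≠ p.
      entry : ∃[ u ] (Q i u × Admissible v u v)
      entry =
        let (z , differ) = a→v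
            (u , u∉ , u→v) = split-decision differ (settle-v z) (flipAt-agrees (settle-v (flipAt z a)))
        in u , u∉ ∘ inj₁ , u→v , off-packing-into-v (u∉ ∘ inj₂) , inj₁ refl
        where
        flipAt-agrees : ∀ {z R} → f (flipAt z a) v ≡ flipAt z a p ⊎ R → f (flipAt z a) v ≡ z p ⊎ R
        flipAt-agrees {z} = Sum.map₁ λ eq → trans eq (flipAt-other z (a≢p ∘ sym))
        settle-v : ∀ z → f z v ≡ z p ⊎ ∃[ w ] (¬ (B i w ⊎ w ≡ p) × IG f w v)
        settle-v z = settle (λ w → excess? (Y i) (X i) w ⊎-dec (w ≟ p)) (z p) z (bound-S (z p) Sv)
          λ { (inj₁ Bw) → inj₁ Bw ; (inj₂ refl) → inj₂ (bound-S (z p) Sp) }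

      -- As for entry, with f_h(z) = X_i h unless h has an in-neighbour outside B_i.
      continue : ∀ {h u′} → X i h ≡ Y i h → IG f u′ h → ∃[ u ] (Q i u × IG f u h)
      continue {h} Xh≡Yh (z , differ) = split-decision differ (settle-h z) (settle-h (flipAt z _))
        where
        settle-h : ∀ z → f z h ≡ X i h ⊎ ∃[ w ] (Q i w × IG f w h)
        settle-h z = settle (excess? (Y i) (X i)) (X i h) z (bound-E (X i h) refl (sym Xh≡Yh)) inj₁

      record Frontier : Set where
        field
          {tip next} : Fin n
          tip-Q      : Q i tip
          edge       : Admissible v tip next
          walk       : Star (Admissible v) next v
          unique     : Unique (vertices walk)
          settled    : All (λ w → X i w ≡ Y i w × OffPacking w) (departures walk)

        to-v : Star (Admissible v) tip v
        to-v = edge ◅ walk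

      open Frontier

      size : Frontier → ℕ
      size F = length (vertices (walk F))

      size≤ : ∀ F → size F ≤ n
      size≤ F = unique⇒length≤ (unique F)

      leave : ∀ {x y} → Induced (Q i) (IG f) x y → y ∉ verts (C i) → Admissible v x y
      leave (_ , Qy , x→y) y∉Ci =
        let y-off = Q⇒offPacking Qy y∉Ci in x→y , offPacking⇒offPackingArc y-off , inj₂ y-off

      -- By initiality v reaches the tip; leave C_i for the last time on that walk.
      return-to-cycle : ∀ F → S i (tip F) → tip F ∉ verts (C i) → Supplied i v
      return-to-cycle F S-tip tip∉Ci with last-exit (_∈? verts (C i)) v∈Ci tip∉Ci v⇝tip
        where
        all-Q : All (Q i) (vertices (to-v F))
        all-Q = tip-Q F ∷ Allₚ.++⁺ (All.map (E⇒Q ∘ proj₁) (settled F)) (S⇒Q Sv ∷ [])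
        v⇝tip : Reach i v (tip F)
        v⇝tip = initial i S-tip v∈Ci
          (Star.map (λ (Qx , Qy , arc) → Qx , Qy , proj₁ arc) (induce (to-v F) all-Q))
      ... | c , _ , c∈Ci , c→y , y∉Ci , y⇝tip =
        inj₁ (c , c∈Ci , admissible⇒principal (leave c→y y∉Ci)
                           (Star.map (λ (arc , b∉) → leave arc b∉) y⇝tip ◅◅ to-v F))

      -- A repetition would close a cycle through vertices with X_i = Y_i, which avoids I.
      no-return-to-walk : ∀ F → tip F ∉ verts (C i) → tip F ∉ vertices (walk F)
      no-return-to-walk F tip∉Ci tip∈walk with cycle-through (walk F) (unique F) tip∈walk (edge F)
      ... | C′ , C′⊆walk , v∈C′⇒tip≡v with fvs (cycle-map proj₁ C′)
      ...   | w , w∈C′ , w∈I with ∈-++⁻ (departures (walk F)) (C′⊆walk w∈C′)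
      ...     | inj₁ w∈dep        = E∉I (proj₁ (All.lookup (settled F) w∈dep)) w∈I
      ...     | inj₂ (here refl) = tip∉Ci (subst (_∈ verts (C i)) (sym (v∈C′⇒tip≡v w∈C′)) v∈Ci)

      step : ∀ F → Supplied i v ⊎ Σ Frontier λ F′ → size F < size F′
      step F with tip F ∈? verts (C i) | Q⇒S⊎E (tip-Q F)
      ... | yes tip∈Ci | _         = inj₁ (inj₁ (tip F , tip∈Ci , admissible⇒principal (edge F) (walk F)))
      ... | no tip∉Ci  | inj₁ S-tip = inj₁ (return-to-cycle F S-tip tip∉Ci)
      ... | no tip∉Ci  | inj₂ E-tip with any? (λ u → IG? u (tip F))
      ...   | no no-arc =
        inj₁ (inj₂ (tip F , (λ u arc → no-arc (u , arc)) , admissible⇒principal (edge F) (walk F)))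
      ...   | yes (_ , arc) =
        let (u , Qu , u→tip) = continue E-tip arc
            tip-off = Q⇒offPacking (tip-Q F) tip∉Ci
        in inj₂ (record
             { tip-Q   = Qu
             ; edge    = u→tip , offPacking⇒offPackingArc tip-off , inj₂ tip-off
             ; walk    = to-v F
             ; unique  = ¬Any⇒All¬ _ (no-return-to-walk F tip∉Ci) ∷ unique F
             ; settled = (E-tip , tip-off) ∷ settled F
             } , n<1+n _)

      supplied : Supplied i v
      supplied =
        let (u , Qu , u→v) = entry
        in ascend size size≤ step
             record { tip-Q = Qu ; edge = u→v ; walk = ε ; unique = [] ∷ [] ; settled = [] }

    special : SpecialPacking C
    special i v v∈Ci (_ , _ , s , _ , mids , (chain , _) , arcs-off , _) =
      let (a , a→v) = consec-pred {x = s} (∈-++⁺ʳ mids (here refl))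
      in Backtrack.supplied i v∈Ci (chain-consec chain a→v) (λ j → arcs-off j a v a→v)

  special-packing : Σ (Fin k → Cycle (IG f)) λ C → Packing C × SpecialPacking C
  special-packing = C , packing C C⊆S initial , special C C⊆S initial
    where
    C : Fin k → Cycle (IG f)
    C i = proj₁ (initial-cycle i)
    C⊆S : ∀ i {v} → v ∈ verts (C i) → S i v
    C⊆S i = proj₁ (proj₂ (initial-cycle i))
    initial : ∀ i → Initial i (C i)
    initial i = proj₂ (proj₂ (initial-cycle i))

map-≤⁻ : ∀ {n} {a b : State n} I → Pointwise _≤ᵇ_ (map a I) (map b I) →
  ∀ {u} → u ∈ I → a u ≤ᵇ b u
map-≤⁻ (_ ∷ I) (le ∷ _)  (here refl) = le
map-≤⁻ (_ ∷ I) (_ ∷ les) (there u∈)  = map-≤⁻ I les u∈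

map-≰⇒excess : ∀ {n} {a b : State n} I → ¬ Pointwise _≤ᵇ_ (map a I) (map b I) → ∃ (Excess a b)
map-≰⇒excess {a = a} {b} I a≰b with any? (excess? a b)
... | yes excess = excess
... | no ∄excess = ⊥-elim (a≰b (everywhere I))
  where
  everywhere : ∀ I → Pointwise _≤ᵇ_ (map a I) (map b I)
  everywhere []      = []
  everywhere (u ∷ I) = ¬excess⇒≤ (∄excess ∘ (u ,_)) ∷ everywhere I

map-not⁻ : ∀ {n} {a b : State n} I → map a I ≡ map not (map b I) → ∀ {u} → u ∈ I → a u ≡ not (b u)
map-not⁻ (_ ∷ I) eq (here refl) = proj₁ (∷-injective eq)
map-not⁻ (_ ∷ I) eq (there u∈)  = map-not⁻ I (proj₂ (∷-injective eq)) u∈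

lemma5 : ∀ {n} (f : State n → State n) → Monotone f →
    (I : List (Fin n)) → Unique I → FeedbackVertexSet (IG f) I →
    (k : ℕ) → SpecialPattern (FixRestr f I) k →
    Σ (Fin k → Cycle (IG f)) λ C → Packing C × SpecialPacking C
lemma5 f mono I _ fvs k (xs , ys , xs-fixed , ys-fixed , _ , _ , order , complement) =
  SpecialPackingConstruction.special-packing f mono I fvs X Y fix-X fix-Y X≤Y complementary X≰Y
  where
  open MonotoneNetwork f mono
  X Y : Fin k → State _
  X i = proj₁ (xs-fixed i)
  Y i = proj₁ (ys-fixed i)
  fix-X : ∀ i → FixedPoint f (X i)
  fix-X i = proj₁ (proj₂ (xs-fixed i))
  fix-Y : ∀ i → FixedPoint f (Y i)
  fix-Y i = proj₁ (proj₂ (ys-fixed i))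
  X↾I : ∀ i → map (X i) I ≡ xs i
  X↾I i = proj₂ (proj₂ (xs-fixed i))
  Y↾I : ∀ i → map (Y i) I ≡ ys i
  Y↾I i = proj₂ (proj₂ (ys-fixed i))
  X≤Y : ∀ i j → i ≢ j → X i ≤ₛ Y j
  X≤Y i j i≢j = fixedPoint-≤ fvs (fix-X i) (fix-Y j)
    (map-≤⁻ I (subst₂ _≤ₗ_ (sym (X↾I i)) (sym (Y↾I j)) (Equivalence.from (order i j) i≢j)))
  complementary : ∀ i {u} → u ∈ I → Y i u ≡ not (X i u)
  complementary i = map-not⁻ I (trans (Y↾I i) (trans (complement i) (cong (map not) (sym (X↾I i)))))
  X≰Y : ∀ i → ∃ (Excess (X i) (Y i))
  X≰Y i = map-≰⇒excess I λ le → Equivalence.to (order i i) (subst₂ _≤ₗ_ (X↾I i) (Y↾I i) le) refl
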